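{- Let $n\ge1$ and $h$ be integers with $1\le h\le\lceil\frac{n+1}{2}\rceil$, and let $S(x,n,h)$ be the staircase palindromic polynomial of degree $n$ and height $h$. If $h>1$, then $$S(x,n,h)=\prod_{\substack{\delta\mid h\\ \delta\neq1}}\Psi_\delta(x)\cdot\prod_{\substack{\tau\mid n+2-h\\ \tau\neq 1}}\Psi_\tau(x),$$ where $\delta$ and $\tau$ range over the positive divisors of $h$ and of $n+2-h$ respectively. Moreover, $$S(x,n,1)=\prod_{\substack{\tau_1\mid n+1\\ \tau_1\neq 1}}\Psi_{\tau_1}(x),$$ where $\tau_1$ ranges over the positive divisors of $n+1$.
   Context: $\Psi_k(x)$ denotes the $k$-th cyclotomic polynomial. For integers $n\ge1$ and $1\le h\le\lceil\frac{n+1}{2}\rceil$, the staircase palindromic (SP) polynomial $S(x,n,h)=\sum_{k=0}^n a_k x^k$ is the polynomial of degree $n$ whose coefficients satisfy $a_\ell=a_{n-\ell}=\ell+1$ for $\ell=0,1,\dots,h-1$ and $a_{h-1}=a_h=\dots=a_{n-h+1}=h$; i.e. $S(x,n,h)=1+2x+\dots+(h-1)x^{h-2}+hx^{h-1}+\dots+hx^{n-h+1}+(h-1)x^{n-h+2}+\dots+2x^{n-1}+x^n$. -}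

module Defs where

open import Data.Nat using (ℕ; zero; suc; _+_; _∸_; _<_; _<?_; _≤_; ⌈_/2⌉)
open import Data.Nat.Divisibility using (_∣_; _∣?_)
open import Data.Integer using (ℤ; +_; -[1+_]) renaming (_+_ to _+ℤ_; _*_ to _*ℤ_)
open import Data.List using (List; []; _∷_; map; filter; foldr; replicate; _++_; [_])
open import Relation.Nullary using (¬_; does)
open import Relation.Binary.PropositionalEquality using (_≡_)
open import Data.Bool using (if_then_else_)

-- Polynomials over ℤ as coefficient lists (constant term first).
Poly : Set
Poly = List ℤ

coeff : Poly → ℕ → ℤ
coeff []       _       = + 0
coeff (a ∷ p)  zero    = a
coeff (a ∷ p)  (suc i) = coeff p i

-- polynomial equality: all coefficients agree (trailing zeros irrelevant)
infix 4 _≈P_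
_≈P_ : Poly → Poly → Set
p ≈P q = ∀ i → coeff p i ≡ coeff q i

addP : Poly → Poly → Poly
addP []       q        = q
addP (a ∷ p)  []       = a ∷ p
addP (a ∷ p)  (b ∷ q)  = (a +ℤ b) ∷ addP p q

scaleP : ℤ → Poly → Poly
scaleP c = map (c *ℤ_)

mulP : Poly → Poly → Poly
mulP []       q = []
mulP (a ∷ p)  q = addP (scaleP a q) (+ 0 ∷ mulP p q)

oneP : Poly
oneP = + 1 ∷ []

prodP : List Poly → Poly
prodP = foldr mulP oneP

-- x^k - 1  (intended for k ≥ 1)
xPowMinusOne : ℕ → Poly
xPowMinusOne k = -[1+ 0 ] ∷ (replicate (k ∸ 1) (+ 0) ++ [ + 1 ])

range1 : ℕ → List ℕ
range1 zero    = []
range1 (suc k) = range1 k ++ [ suc k ]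

divisors : ℕ → List ℕ
divisors k = filter (λ d → d ∣? k) (range1 k)

divisorsNe1 : ℕ → List ℕ
divisorsNe1 k = filter (λ d → 1 <? d) (divisors k)

-- Ψ is the family of cyclotomic polynomials: x^k - 1 = ∏_{d ∣ k} Ψ_d(x) for all k ≥ 1.
-- (This determines Ψ_k uniquely for every k ≥ 1, by induction on k, since ℤ[x] is a domain.)
IsCyclotomic : (ℕ → Poly) → Set
IsCyclotomic Ψ = ∀ k → 1 ≤ k → prodP (map Ψ (divisors k)) ≈P xPowMinusOne k

spCoeff : ℕ → ℕ → ℕ → ℕ
spCoeff n h ℓ =
  if does (ℓ <? h) then suc ℓ
  else if does ((n ∸ ℓ) <? h) then suc (n ∸ ℓ)
  else h

rangeFrom0 : ℕ → List ℕ
rangeFrom0 zero    = []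
rangeFrom0 (suc k) = rangeFrom0 k ++ [ k ]

SP : ℕ → ℕ → Poly
SP n h = map (λ ℓ → + spCoeff n h ℓ) (rangeFrom0 (suc n))

-- Writing [k] = 1 + x + ⋯ + x^(k-1) (ones k below), the staircase polynomial is S(x,n,h) = [h]·[n+2-h]:
-- the coefficient of x^i in [h]·[m] counts the a < h with 0 ≤ i - a < m, which is
-- min(i+1,h) - max(0,i+1-m), and this is the staircase when h ≤ m and h + m = n + 2.
-- On the other hand (x - 1)·[k] = x^k - 1 = Ψ_1(x)·∏_{1 ≠ d ∣ k} Ψ_d(x) with Ψ_1 = x - 1,
-- and x - 1 can be cancelled, so [k] = ∏_{1 ≠ d ∣ k} Ψ_d(x).
module Submission where

open import Defs
open import Data.Nat as ℕ
  using (ℕ; zero; suc; _+_; _∸_; _⊓_; _<_; _≤_; ⌈_/2⌉; ⌊_/2⌋; z≤n; s≤s; _<?_; _≤?_)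
import Data.Nat.Properties as ℕ
open import Data.Nat.Divisibility using (_∣?_; 1∣_)
open import Data.Integer as ℤ using (ℤ; +_; -[1+_]; -_) renaming (_+_ to _+ℤ_; _*_ to _*ℤ_)
import Data.Integer.Properties as ℤ
open import Algebra.Properties.AbelianGroup ℤ.+-0-abelianGroup using (∙-cancelʳ)
open import Data.List using (List; []; _∷_; map; filter; replicate; _++_; [_])
import Data.List.Properties as List
open import Data.List.Relation.Unary.All using (All; []; _∷_)
import Data.List.Relation.Unary.All.Properties as All
open import Data.Product using (∃-syntax; _×_; _,_)
open import Relation.Nullary using (yes; no; ¬_)
open import Relation.Nullary.Decidable using (dec-true; dec-false)
open import Relation.Binary.PropositionalEquality hiding ([_])
open ≡-Reasoning

coeff-addP : ∀ p q i → coeff (addP p q) i ≡ coeff p i +ℤ coeff q i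
coeff-addP []      q       i       = sym (ℤ.+-identityˡ _)
coeff-addP (a ∷ p) []      i       = sym (ℤ.+-identityʳ _)
coeff-addP (a ∷ p) (b ∷ q) zero    = refl
coeff-addP (a ∷ p) (b ∷ q) (suc i) = coeff-addP p q i

coeff-scaleP : ∀ c q i → coeff (scaleP c q) i ≡ c *ℤ coeff q i
coeff-scaleP c []      i       = sym (ℤ.*-zeroʳ c)
coeff-scaleP c (a ∷ q) zero    = refl
coeff-scaleP c (a ∷ q) (suc i) = coeff-scaleP c q i

coeff-mulP-zero : ∀ a p q → coeff (mulP (a ∷ p) q) zero ≡ a *ℤ coeff q zero
coeff-mulP-zero a p q = begin
  coeff (mulP (a ∷ p) q) zero    ≡⟨ coeff-addP (scaleP a q) _ zero ⟩
  coeff (scaleP a q) zero +ℤ + 0 ≡⟨ ℤ.+-identityʳ _ ⟩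
  coeff (scaleP a q) zero        ≡⟨ coeff-scaleP a q zero ⟩
  a *ℤ coeff q zero              ∎

coeff-mulP-suc : ∀ a p q i →
  coeff (mulP (a ∷ p) q) (suc i) ≡ a *ℤ coeff q (suc i) +ℤ coeff (mulP p q) i
coeff-mulP-suc a p q i = trans (coeff-addP (scaleP a q) _ (suc i))
  (cong (_+ℤ coeff (mulP p q) i) (coeff-scaleP a q (suc i)))

mulP-zeroˡ : ∀ p q → p ≈P [] → mulP p q ≈P []
mulP-zeroˡ []      q p≈0 i = refl
mulP-zeroˡ (a ∷ p) q p≈0 zero = begin
  coeff (mulP (a ∷ p) q) zero ≡⟨ coeff-mulP-zero a p q ⟩
  a *ℤ coeff q zero           ≡⟨ cong (_*ℤ coeff q zero) (p≈0 zero) ⟩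
  + 0                         ∎
mulP-zeroˡ (a ∷ p) q p≈0 (suc i) = begin
  coeff (mulP (a ∷ p) q) (suc i)                  ≡⟨ coeff-mulP-suc a p q i ⟩
  a *ℤ coeff q (suc i) +ℤ coeff (mulP p q) i      ≡⟨ cong₂ _+ℤ_ (cong (_*ℤ coeff q (suc i)) (p≈0 zero))
                                                           (mulP-zeroˡ p q (λ j → p≈0 (suc j)) i) ⟩
  + 0                                             ∎

mulP-congˡ : ∀ p p′ q → p ≈P p′ → mulP p q ≈P mulP p′ q
mulP-congˡ []      p′       q p≈p′ i = sym (mulP-zeroˡ p′ q (λ j → sym (p≈p′ j)) i)
mulP-congˡ (a ∷ p) []       q p≈p′ = mulP-zeroˡ (a ∷ p) q p≈p′
mulP-congˡ (a ∷ p) (b ∷ p′) q p≈p′ zero = begin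
  coeff (mulP (a ∷ p) q) zero  ≡⟨ coeff-mulP-zero a p q ⟩
  a *ℤ coeff q zero            ≡⟨ cong (_*ℤ coeff q zero) (p≈p′ zero) ⟩
  b *ℤ coeff q zero            ≡⟨ coeff-mulP-zero b p′ q ⟨
  coeff (mulP (b ∷ p′) q) zero ∎
mulP-congˡ (a ∷ p) (b ∷ p′) q p≈p′ (suc i) = begin
  coeff (mulP (a ∷ p) q) (suc i)              ≡⟨ coeff-mulP-suc a p q i ⟩
  a *ℤ coeff q (suc i) +ℤ coeff (mulP p q) i  ≡⟨ cong₂ _+ℤ_ (cong (_*ℤ coeff q (suc i)) (p≈p′ zero))
                                                       (mulP-congˡ p p′ q (λ j → p≈p′ (suc j)) i) ⟩
  b *ℤ coeff q (suc i) +ℤ coeff (mulP p′ q) i ≡⟨ coeff-mulP-suc b p′ q i ⟨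
  coeff (mulP (b ∷ p′) q) (suc i)             ∎

mulP-congʳ : ∀ p q q′ → q ≈P q′ → mulP p q ≈P mulP p q′
mulP-congʳ []      q q′ q≈q′ i = refl
mulP-congʳ (a ∷ p) q q′ q≈q′ zero = begin
  coeff (mulP (a ∷ p) q) zero  ≡⟨ coeff-mulP-zero a p q ⟩
  a *ℤ coeff q zero            ≡⟨ cong (a *ℤ_) (q≈q′ zero) ⟩
  a *ℤ coeff q′ zero           ≡⟨ coeff-mulP-zero a p q′ ⟨
  coeff (mulP (a ∷ p) q′) zero ∎
mulP-congʳ (a ∷ p) q q′ q≈q′ (suc i) = begin
  coeff (mulP (a ∷ p) q) (suc i)               ≡⟨ coeff-mulP-suc a p q i ⟩
  a *ℤ coeff q (suc i) +ℤ coeff (mulP p q) i   ≡⟨ cong₂ _+ℤ_ (cong (a *ℤ_) (q≈q′ (suc i)))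
                                                        (mulP-congʳ p q q′ q≈q′ i) ⟩
  a *ℤ coeff q′ (suc i) +ℤ coeff (mulP p q′) i ≡⟨ coeff-mulP-suc a p q′ i ⟨
  coeff (mulP (a ∷ p) q′) (suc i)              ∎

mulP-identityˡ : ∀ p → mulP oneP p ≈P p
mulP-identityˡ p zero    = trans (coeff-mulP-zero (+ 1) [] p) (ℤ.*-identityˡ _)
mulP-identityˡ p (suc i) = trans (coeff-mulP-suc (+ 1) [] p i)
  (trans (ℤ.+-identityʳ _) (ℤ.*-identityˡ _))

mulP-identityʳ : ∀ p → mulP p oneP ≈P p
mulP-identityʳ []      i       = refl
mulP-identityʳ (a ∷ p) zero    = trans (coeff-mulP-zero a p oneP) (ℤ.*-identityʳ a)
mulP-identityʳ (a ∷ p) (suc i) = begin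
  coeff (mulP (a ∷ p) oneP) (suc i)          ≡⟨ coeff-mulP-suc a p oneP i ⟩
  a *ℤ + 0 +ℤ coeff (mulP p oneP) i          ≡⟨ cong (_+ℤ coeff (mulP p oneP) i) (ℤ.*-zeroʳ a) ⟩
  + 0 +ℤ coeff (mulP p oneP) i               ≡⟨ ℤ.+-identityˡ _ ⟩
  coeff (mulP p oneP) i                      ≡⟨ mulP-identityʳ p i ⟩
  coeff p i                                  ∎

xMinusOne : Poly
xMinusOne = -[1+ 0 ] ∷ + 1 ∷ []

coeff-xMinusOne*-zero : ∀ q → coeff (mulP xMinusOne q) zero ≡ - coeff q zero
coeff-xMinusOne*-zero q = trans (coeff-mulP-zero -[1+ 0 ] (+ 1 ∷ []) q) (ℤ.-1*i≡-i (coeff q zero))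

coeff-xMinusOne*-suc : ∀ q i → coeff (mulP xMinusOne q) (suc i) ≡ - coeff q (suc i) +ℤ coeff q i
coeff-xMinusOne*-suc q i = trans (coeff-mulP-suc -[1+ 0 ] (+ 1 ∷ []) q i)
  (cong₂ _+ℤ_ (ℤ.-1*i≡-i (coeff q (suc i))) (mulP-identityˡ q i))

xMinusOne*-cancel : ∀ p q → mulP xMinusOne p ≈P mulP xMinusOne q → p ≈P q
xMinusOne*-cancel p q eq zero = ℤ.neg-injective (begin
  - coeff p zero                ≡⟨ coeff-xMinusOne*-zero p ⟨
  coeff (mulP xMinusOne p) zero ≡⟨ eq zero ⟩
  coeff (mulP xMinusOne q) zero ≡⟨ coeff-xMinusOne*-zero q ⟩
  - coeff q zero                ∎)
xMinusOne*-cancel p q eq (suc i) = ℤ.neg-injective (∙-cancelʳ (coeff q i) _ _ (begin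
  - coeff p (suc i) +ℤ coeff q i   ≡⟨ cong (- coeff p (suc i) +ℤ_) (xMinusOne*-cancel p q eq i) ⟨
  - coeff p (suc i) +ℤ coeff p i   ≡⟨ coeff-xMinusOne*-suc p i ⟨
  coeff (mulP xMinusOne p) (suc i) ≡⟨ eq (suc i) ⟩
  coeff (mulP xMinusOne q) (suc i) ≡⟨ coeff-xMinusOne*-suc q i ⟩
  - coeff q (suc i) +ℤ coeff q i   ∎))

ones : ℕ → Poly
ones k = replicate k (+ 1)

xMinusOne*ones : ∀ k → mulP xMinusOne (ones (suc k)) ≈P xPowMinusOne (suc k)
xMinusOne*ones k zero    = coeff-xMinusOne*-zero (ones (suc k))
xMinusOne*ones k (suc i) = trans (coeff-xMinusOne*-suc (ones (suc k)) i) (telescope k i)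
  where
    telescope : ∀ k i → - coeff (ones (suc k)) (suc i) +ℤ coeff (ones (suc k)) i
                      ≡ coeff (replicate k (+ 0) ++ [ + 1 ]) i
    telescope zero    zero    = refl
    telescope zero    (suc i) = refl
    telescope (suc k) zero    = refl
    telescope (suc k) (suc i) = telescope k i

range1-suc : ∀ k → ∃[ ds ] range1 (suc k) ≡ 1 ∷ ds × All (1 <_) ds
range1-suc zero = [] , refl , []
range1-suc (suc k) with range1-suc k
... | ds , range1≡ , ds>1 =
  ds ++ [ suc (suc k) ] , cong (_++ [ suc (suc k) ]) range1≡ , All.++⁺ ds>1 (s≤s (s≤s z≤n) ∷ [])

divisors-suc : ∀ k → divisors (suc k) ≡ 1 ∷ divisorsNe1 (suc k)
divisors-suc k with range1-suc k
... | ds , range1≡ , ds>1 = trans divisors≡ (cong (1 ∷_) (sym divisorsNe1≡))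
  where
    divisors>1 : List ℕ
    divisors>1 = filter (_∣? suc k) ds

    divisors≡ : divisors (suc k) ≡ 1 ∷ divisors>1
    divisors≡ = trans (cong (filter (_∣? suc k)) range1≡) (List.filter-accept (_∣? suc k) (1∣ suc k))

    divisorsNe1≡ : divisorsNe1 (suc k) ≡ divisors>1
    divisorsNe1≡ = begin
      filter (1 <?_) (divisors (suc k))    ≡⟨ cong (filter (1 <?_)) divisors≡ ⟩
      filter (1 <?_) (1 ∷ divisors>1)  ≡⟨ List.filter-reject (1 <?_) {xs = divisors>1} (ℕ.<-irrefl refl) ⟩
      filter (1 <?_) divisors>1        ≡⟨ List.filter-all (1 <?_) (All.filter⁺ (_∣? suc k) ds>1) ⟩
      divisors>1                       ∎

module _ (Ψ : ℕ → Poly) (cyclotomic : IsCyclotomic Ψ) where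

  Ψ₁≈xMinusOne : Ψ 1 ≈P xMinusOne
  Ψ₁≈xMinusOne i = trans (sym (mulP-identityʳ (Ψ 1) i)) (cyclotomic 1 (s≤s z≤n) i)

  prod-Ψ-divisorsNe1≈ones : ∀ k → 1 ≤ k → prodP (map Ψ (divisorsNe1 k)) ≈P ones k
  prod-Ψ-divisorsNe1≈ones (suc k) _ = xMinusOne*-cancel P (ones (suc k)) λ i → begin
    coeff (mulP xMinusOne P) i                   ≡⟨ mulP-congˡ (Ψ 1) xMinusOne P Ψ₁≈xMinusOne i ⟨
    coeff (mulP (Ψ 1) P) i                       ≡⟨ cong (λ ds → coeff (prodP (map Ψ ds)) i) (divisors-suc k) ⟨
    coeff (prodP (map Ψ (divisors (suc k)))) i   ≡⟨ cyclotomic (suc k) (s≤s z≤n) i ⟩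
    coeff (xPowMinusOne (suc k)) i               ≡⟨ xMinusOne*ones k i ⟨
    coeff (mulP xMinusOne (ones (suc k))) i      ∎
    where
      P : Poly
      P = prodP (map Ψ (divisorsNe1 (suc k)))

m+n≤o⇒m≤o∸n : ∀ {m n o} → m + n ≤ o → m ≤ o ∸ n
m+n≤o⇒m≤o∸n {m} {n} m+n≤o = subst (_≤ _ ∸ n) (ℕ.m+n∸n≡m m n) (ℕ.∸-monoˡ-≤ n m+n≤o)

m≤⌊n/2⌋⇒m+m≤n : ∀ {m} n → m ≤ ⌊ n /2⌋ → m + m ≤ n
m≤⌊n/2⌋⇒m+m≤n n m≤⌊n/2⌋ = ℕ.≤-trans
  (ℕ.+-mono-≤ m≤⌊n/2⌋ (ℕ.≤-trans m≤⌊n/2⌋ (ℕ.⌊n/2⌋≤⌈n/2⌉ n)))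
  (ℕ.≤-reflexive (ℕ.⌊n/2⌋+⌈n/2⌉≡n n))

m+n≡o+p⇒m∸p≡o∸n : ∀ m n o p → m + n ≡ o + p → m ∸ p ≡ o ∸ n
m+n≡o+p⇒m∸p≡o∸n m n o p eq = begin
  m ∸ p               ≡⟨ ℕ.[m+n]∸[m+o]≡n∸o n m p ⟨
  (n + m) ∸ (n + p)   ≡⟨ cong₂ _∸_ (trans (ℕ.+-comm n m) eq) (ℕ.+-comm n p) ⟩
  (o + p) ∸ (p + n)   ≡⟨ cong (_∸ (p + n)) (ℕ.+-comm o p) ⟩
  (p + o) ∸ (p + n)   ≡⟨ ℕ.[m+n]∸[m+o]≡n∸o p o n ⟩
  o ∸ n               ∎

coeff-ones-< : ∀ {k i} → i < k → coeff (ones k) i ≡ + 1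
coeff-ones-< {suc k} {zero}  _         = refl
coeff-ones-< {suc k} {suc i} (s≤s i<k) = coeff-ones-< i<k

coeff-ones-≥ : ∀ {k i} → k ≤ i → coeff (ones k) i ≡ + 0
coeff-ones-≥ {zero}  {i}     _         = refl
coeff-ones-≥ {suc k} {suc i} (s≤s k≤i) = coeff-ones-≥ k≤i

trapezoid : ℕ → ℕ → ℕ → ℕ
trapezoid h m i = (suc i ⊓ h) ∸ (suc i ∸ m)

coeff-ones*ones : ∀ h m i → coeff (mulP (ones h) (ones m)) i ≡ + trapezoid h m i
coeff-ones*ones zero    m       i       = cong +_ (sym (ℕ.0∸n≡0 (suc i ∸ m)))
coeff-ones*ones (suc h) zero    zero    = refl
coeff-ones*ones (suc h) (suc m) zero    = cong (λ k → + (1 ∸ k)) (sym (ℕ.0∸n≡0 m))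
coeff-ones*ones (suc h) m       (suc i) with suc i <? m
... | yes i+1<m = begin
  coeff (mulP (ones (suc h)) (ones m)) (suc i)                      ≡⟨ coeff-mulP-suc (+ 1) (ones h) (ones m) i ⟩
  + 1 *ℤ coeff (ones m) (suc i) +ℤ coeff (mulP (ones h) (ones m)) i ≡⟨ cong₂ (λ a b → + 1 *ℤ a +ℤ b) (coeff-ones-< i+1<m) (coeff-ones*ones h m i) ⟩
  + suc (trapezoid h m i)                                           ≡⟨ cong (λ k → + suc ((suc i ⊓ h) ∸ k)) (ℕ.m≤n⇒m∸n≡0 (ℕ.<⇒≤ i+1<m)) ⟩
  + suc (suc i ⊓ h)                                                 ≡⟨ cong (λ k → + (suc (suc i ⊓ h) ∸ k)) (ℕ.m≤n⇒m∸n≡0 i+1<m) ⟨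
  + trapezoid (suc h) m (suc i)                                     ∎
... | no i+1≮m = begin
  coeff (mulP (ones (suc h)) (ones m)) (suc i)                      ≡⟨ coeff-mulP-suc (+ 1) (ones h) (ones m) i ⟩
  + 1 *ℤ coeff (ones m) (suc i) +ℤ coeff (mulP (ones h) (ones m)) i ≡⟨ cong₂ (λ a b → + 1 *ℤ a +ℤ b) (coeff-ones-≥ (ℕ.≮⇒≥ i+1≮m)) (coeff-ones*ones h m i) ⟩
  + trapezoid h m i                                                 ≡⟨ cong (λ k → + (suc (suc i ⊓ h) ∸ k)) (ℕ.+-∸-assoc 1 (ℕ.≮⇒≥ i+1≮m)) ⟨
  + trapezoid (suc h) m (suc i)                                     ∎

spCoeff-rising : ∀ {n h i} → i < h → spCoeff n h i ≡ suc i
spCoeff-rising {n} {h} {i} i<h rewrite dec-true (i <? h) i<h = refl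

spCoeff-falling : ∀ {n h i} → ¬ i < h → n ∸ i < h → spCoeff n h i ≡ suc (n ∸ i)
spCoeff-falling {n} {h} {i} i≮h n∸i<h
  rewrite dec-false (i <? h) i≮h | dec-true (n ∸ i <? h) n∸i<h = refl

spCoeff-flat : ∀ {n h i} → ¬ i < h → ¬ n ∸ i < h → spCoeff n h i ≡ h
spCoeff-flat {n} {h} {i} i≮h n∸i≮h
  rewrite dec-false (i <? h) i≮h | dec-false (n ∸ i <? h) n∸i≮h = refl

trapezoid-rising : ∀ {h m i} → i < h → h ≤ m → trapezoid h m i ≡ suc i
trapezoid-rising i<h h≤m = cong₂ _∸_ (ℕ.m≤n⇒m⊓n≡m i<h) (ℕ.m≤n⇒m∸n≡0 (ℕ.≤-trans i<h h≤m))

trapezoid-falling : ∀ {h m i d} → suc i + suc d ≡ h + m → d < h → h ≤ i → trapezoid h m i ≡ suc d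
trapezoid-falling {h} {m} {i} {d} i+d+2≡h+m d<h h≤i = begin
  (suc i ⊓ h) ∸ (suc i ∸ m) ≡⟨ cong₂ _∸_ (ℕ.m≥n⇒m⊓n≡n (ℕ.m≤n⇒m≤1+n h≤i)) (m+n≡o+p⇒m∸p≡o∸n (suc i) (suc d) h m i+d+2≡h+m) ⟩
  h ∸ (h ∸ suc d)           ≡⟨ ℕ.m∸[m∸n]≡n d<h ⟩
  suc d                     ∎

trapezoid-flat : ∀ {h m i d} → suc i + suc d ≡ h + m → h ≤ d → h ≤ i → trapezoid h m i ≡ h
trapezoid-flat {h} {m} {i} {d} i+d+2≡h+m h≤d h≤i = cong₂ _∸_ (ℕ.m≥n⇒m⊓n≡n (ℕ.m≤n⇒m≤1+n h≤i))
  (trans (m+n≡o+p⇒m∸p≡o∸n (suc i) (suc d) h m i+d+2≡h+m) (ℕ.m≤n⇒m∸n≡0 (ℕ.m≤n⇒m≤1+n h≤d)))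

trapezoid-vanishes : ∀ {n h m i} → n + 2 ≡ h + m → n < i → trapezoid h m i ≡ 0
trapezoid-vanishes {n} {h} {m} {i} n+2≡h+m n<i =
  trans (cong (_∸ (suc i ∸ m)) (ℕ.m≥n⇒m⊓n≡n h≤i+1)) (ℕ.m≤n⇒m∸n≡0 (m+n≤o⇒m≤o∸n {h} {m} h+m≤i+1))
  where
    h+m≤i+1 : h + m ≤ suc i
    h+m≤i+1 = subst (_≤ suc i) (trans (ℕ.+-comm 2 n) n+2≡h+m) (s≤s n<i)
    h≤i+1 : h ≤ suc i
    h≤i+1 = ℕ.≤-trans (ℕ.m≤m+n h m) h+m≤i+1

suc+suc∸ : ∀ {n i} → i ≤ n → suc i + suc (n ∸ i) ≡ n + 2
suc+suc∸ {n} {i} i≤n = begin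
  suc i + suc (n ∸ i)     ≡⟨ cong suc (ℕ.+-suc i (n ∸ i)) ⟩
  suc (suc (i + (n ∸ i))) ≡⟨ cong (λ k → suc (suc k)) (ℕ.m+[n∸m]≡n i≤n) ⟩
  suc (suc n)             ≡⟨ ℕ.+-comm 2 n ⟩
  n + 2                   ∎

spCoeff≡trapezoid : ∀ {n h m i} → n + 2 ≡ h + m → h ≤ m → i ≤ n → spCoeff n h i ≡ trapezoid h m i
spCoeff≡trapezoid {n} {h} {m} {i} n+2≡h+m h≤m i≤n with i <? h | n ∸ i <? h
... | yes i<h | _ =
  trans (spCoeff-rising i<h) (sym (trapezoid-rising i<h h≤m))
... | no i≮h | yes n∸i<h =
  trans (spCoeff-falling i≮h n∸i<h) (sym (trapezoid-falling i+d+2≡h+m n∸i<h (ℕ.≮⇒≥ i≮h)))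
  where
    i+d+2≡h+m : suc i + suc (n ∸ i) ≡ h + m
    i+d+2≡h+m = trans (suc+suc∸ i≤n) n+2≡h+m
... | no i≮h | no n∸i≮h =
  trans (spCoeff-flat i≮h n∸i≮h) (sym (trapezoid-flat i+d+2≡h+m (ℕ.≮⇒≥ n∸i≮h) (ℕ.≮⇒≥ i≮h)))
  where
    i+d+2≡h+m : suc i + suc (n ∸ i) ≡ h + m
    i+d+2≡h+m = trans (suc+suc∸ i≤n) n+2≡h+m

rangeFrom0-suc : ∀ k → rangeFrom0 (suc k) ≡ 0 ∷ map suc (rangeFrom0 k)
rangeFrom0-suc zero    = refl
rangeFrom0-suc (suc k) = begin
  rangeFrom0 (suc k) ++ [ suc k ]                ≡⟨ cong (_++ [ suc k ]) (rangeFrom0-suc k) ⟩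
  0 ∷ (map suc (rangeFrom0 k) ++ map suc [ k ])  ≡⟨ cong (0 ∷_) (List.map-++ suc (rangeFrom0 k) [ k ]) ⟨
  0 ∷ map suc (rangeFrom0 k ++ [ k ])            ∎

coeff-map-rangeFrom0-< : ∀ {k i} (f : ℕ → ℤ) → i < k → coeff (map f (rangeFrom0 k)) i ≡ f i
coeff-map-rangeFrom0-< {suc k} {zero}  f _ rewrite rangeFrom0-suc k = refl
coeff-map-rangeFrom0-< {suc k} {suc i} f (s≤s i<k)
  rewrite rangeFrom0-suc k | sym (List.map-∘ {g = f} {f = suc} (rangeFrom0 k)) =
  coeff-map-rangeFrom0-< (λ j → f (suc j)) i<k

coeff-map-rangeFrom0-≥ : ∀ {k i} (f : ℕ → ℤ) → k ≤ i → coeff (map f (rangeFrom0 k)) i ≡ + 0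
coeff-map-rangeFrom0-≥ {zero}  {i}     f _ = refl
coeff-map-rangeFrom0-≥ {suc k} {suc i} f (s≤s k≤i)
  rewrite rangeFrom0-suc k | sym (List.map-∘ {g = f} {f = suc} (rangeFrom0 k)) =
  coeff-map-rangeFrom0-≥ (λ j → f (suc j)) k≤i

SP≈ones*ones : ∀ {n h m} → n + 2 ≡ h + m → h ≤ m → SP n h ≈P mulP (ones h) (ones m)
SP≈ones*ones {n} {h} {m} n+2≡h+m h≤m i with i ≤? n
... | yes i≤n = begin
  coeff (SP n h) i                  ≡⟨ coeff-map-rangeFrom0-< (λ ℓ → + spCoeff n h ℓ) (s≤s i≤n) ⟩
  + spCoeff n h i                   ≡⟨ cong +_ (spCoeff≡trapezoid n+2≡h+m h≤m i≤n) ⟩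
  + trapezoid h m i                 ≡⟨ coeff-ones*ones h m i ⟨
  coeff (mulP (ones h) (ones m)) i  ∎
... | no i≰n = begin
  coeff (SP n h) i                  ≡⟨ coeff-map-rangeFrom0-≥ (λ ℓ → + spCoeff n h ℓ) (ℕ.≰⇒> i≰n) ⟩
  + 0                               ≡⟨ cong +_ (trapezoid-vanishes {h = h} {m = m} n+2≡h+m (ℕ.≰⇒> i≰n)) ⟨
  + trapezoid h m i                 ≡⟨ coeff-ones*ones h m i ⟨
  coeff (mulP (ones h) (ones m)) i  ∎

mainTheorem2 : (Ψ : ℕ → Poly) → IsCyclotomic Ψ →
    ((n h : ℕ) → 1 ≤ n → 1 ≤ h → h ≤ ⌈ n + 1 /2⌉ → 1 < h →
      SP n h ≈P mulP (prodP (map Ψ (divisorsNe1 h))) (prodP (map Ψ (divisorsNe1 (n + 2 ∸ h)))))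
    × ((n : ℕ) → 1 ≤ n → SP n 1 ≈P prodP (map Ψ (divisorsNe1 (n + 1))))
mainTheorem2 Ψ cyclotomic = height>1 , height≡1
  where
    P : ℕ → Poly
    P k = prodP (map Ψ (divisorsNe1 k))

    height>1 : (n h : ℕ) → 1 ≤ n → 1 ≤ h → h ≤ ⌈ n + 1 /2⌉ → 1 < h → SP n h ≈P mulP (P h) (P (n + 2 ∸ h))
    height>1 n h _ 1≤h h≤⌈n+1/2⌉ _ i = begin
      coeff (SP n h) i                    ≡⟨ SP≈ones*ones n+2≡h+m h≤m i ⟩
      coeff (mulP (ones h) (ones m)) i    ≡⟨ mulP-congˡ (P h) (ones h) (ones m) (prod-Ψ-divisorsNe1≈ones Ψ cyclotomic h 1≤h) i ⟨
      coeff (mulP (P h) (ones m)) i       ≡⟨ mulP-congʳ (P h) (P m) (ones m) (prod-Ψ-divisorsNe1≈ones Ψ cyclotomic m (ℕ.≤-trans 1≤h h≤m)) i ⟨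
      coeff (mulP (P h) (P m)) i          ∎
      where
        m : ℕ
        m = n + 2 ∸ h
        h+h≤n+2 : h + h ≤ n + 2
        h+h≤n+2 = subst (h + h ≤_) (sym (ℕ.+-suc n 1)) (m≤⌊n/2⌋⇒m+m≤n (suc (n + 1)) h≤⌈n+1/2⌉)
        h≤m : h ≤ m
        h≤m = m+n≤o⇒m≤o∸n h+h≤n+2
        n+2≡h+m : n + 2 ≡ h + m
        n+2≡h+m = sym (ℕ.m+[n∸m]≡n (ℕ.≤-trans (ℕ.m≤m+n h h) h+h≤n+2))

    height≡1 : (n : ℕ) → 1 ≤ n → SP n 1 ≈P P (n + 1)
    height≡1 n _ i = begin
      coeff (SP n 1) i                    ≡⟨ SP≈ones*ones (ℕ.+-suc n 1) (ℕ.m≤n+m 1 n) i ⟩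
      coeff (mulP oneP (ones (n + 1))) i  ≡⟨ mulP-identityˡ (ones (n + 1)) i ⟩
      coeff (ones (n + 1)) i              ≡⟨ prod-Ψ-divisorsNe1≈ones Ψ cyclotomic (n + 1) (ℕ.m≤n+m 1 n) i ⟨
      coeff (P (n + 1)) i                 ∎
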